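{- For all integers $n\ge d\ge 1$, $\Sigma_{\mathrm{DR}}(d,n)\le (n-d)^{1+\log_2 d}$.
   Context: Let $S=\{1,\dots,n\}$ (the symbol set) and let $\binom{S}{d}$ denote the set of $d$-element subsets of $S$. A $d$-dimensional subset partition graph on $S$ is a connected graph $G=(\mathcal V,E)$ whose vertex set $\mathcal V=\{\mathcal V_1,\dots,\mathcal V_k\}$ is a partition of some set $\mathcal A\subseteq\binom{S}{d}$: the $\mathcal V_i$ are pairwise disjoint, nonempty, and their union is $\mathcal A$. For $F\subseteq S$, the restriction $G_F$ is the graph obtained from $G$ by replacing $\mathcal A$ with $\mathcal A_F=\{A\in\mathcal A: F\subseteq A\}$, removing every vertex $\mathcal V_i$ with $\mathcal V_i\cap\mathcal A_F=\emptyset$ together with its incident edges, and keeping the remaining vertices and edges among them. $G$ satisfies dimension reduction if for every $F\subseteq S$ with $|F|\le d$ the restriction $G_F$ is connected. The diameter of $G$ is the maximum over pairs of vertices of the graph distance between them. $\Sigma_{\mathrm{DR}}(d,n)$ denotes the maximum diameter among $d$-dimensional subset partition graphs on the symbol set $\{1,\dots,n\}$ satisfying dimension reduction. -}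

module Defs where

open import Data.Nat using (ℕ; zero; suc; _+_; _≤_; _<_; _^_)
open import Data.Fin using (Fin)
open import Data.Fin.Subset using (Subset; _⊆_; ∣_∣)
open import Data.Maybe using (Maybe; just; nothing)
open import Data.Bool using (Bool; true)
open import Data.Unit using (⊤)
open import Data.Product using (Σ; ∃; ∃-syntax; _×_; _,_)
open import Relation.Binary.PropositionalEquality using (_≡_)

-- A d-dimensional subset partition graph on the symbol set S = Fin n
-- with k vertices V_0 … V_{k-1}.
--   * part A ≡ just i  means  A ∈ 𝒜  and  A ∈ V_i ;  part A ≡ nothing  means  A ∉ 𝒜.
--     Hence the V_i are automatically pairwise disjoint and their union is 𝒜.
--   * adj i j ≡ true means {V_i , V_j} is an edge (symmetric).
record SPGraph (d n : ℕ) : Set where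
  field
    k        : ℕ
    part     : Subset n → Maybe (Fin k)
    part-dim : ∀ A i → part A ≡ just i → ∣ A ∣ ≡ d
    nonempty : ∀ i → ∃[ A ] part A ≡ just i
    adj      : Fin k → Fin k → Bool
    adj-sym  : ∀ i j → adj i j ≡ true → adj j i ≡ true

  data Walk (P : Fin k → Set) : Fin k → Fin k → ℕ → Set where
    here : ∀ {i} → P i → Walk P i i zero
    step : ∀ {i j l ℓ} → P i → adj i j ≡ true → Walk P j l ℓ → Walk P i l (suc ℓ)

  -- Vertex V_i survives in the restriction G_F: V_i ∩ 𝒜_F ≠ ∅.
  InRestr : Subset n → Fin k → Set
  InRestr F i = ∃[ A ] (part A ≡ just i × F ⊆ A)

  AllV : Fin k → Set
  AllV _ = ⊤

  RestrConnected : Subset n → Set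
  RestrConnected F = ∀ i j → InRestr F i → InRestr F j → ∃[ ℓ ] Walk (InRestr F) i j ℓ

  Connected : Set
  Connected = ∀ i j → ∃[ ℓ ] Walk AllV i j ℓ

  DimensionReduction : Set
  DimensionReduction = ∀ (F : Subset n) → ∣ F ∣ ≤ d → RestrConnected F

  DiameterAtMost : ℕ → Set
  DiameterAtMost b = ∀ i j → ∃[ ℓ ] (ℓ ≤ b × Walk AllV i j ℓ)

-- x ≤ m ^ (1 + log₂ d), for naturals x, m and d ≥ 1, expressed without reals:
-- for every rational p/q (q ≥ 1) strictly greater than log₂ d (i.e. d^q < 2^p),
-- x ≤ m^(1 + p/q), i.e. x^q ≤ m^(q + p).  By continuity of r ↦ m^(1+r)
-- (and m^(1+r) = 0 for m = 0) this is equivalent to the real inequality.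
LeqPowOnePlusLog₂ : ℕ → ℕ → ℕ → Set
LeqPowOnePlusLog₂ x m d = ∀ p q → 1 ≤ q → d ^ q < 2 ^ p → x ^ q ≤ m ^ (q + p)

-- Fix vertices u and v of G.  The sets of G, layered by the distance of their vertex from v up
-- to the distance of u, form a connected layer family (Eisenbrand, Hähnle, Razborov, Rothvoß):
-- for sets A and B, dimension reduction gives a walk from the vertex of A to that of B inside
-- G_{A∩B}, along which the distance to v changes by at most one.  A connected layer family of
-- d-sets on d + m symbols has at most m · d ^ ⌊log₂ m⌋ ≤ m ^ (1 + log₂ d) layers.  In dimension
-- one every layer brings a new symbol.  Otherwise, if f bounds the number of layers on
-- d + ⌊(m - 2)/2⌋ symbols, the first f + 1 and the last f + 1 layers each cover more than half
-- of the spare symbols, so they share a symbol s; between a set containing s near each end, the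
-- sets containing s form a family of dimension d - 1.  So at most 2 (f + 1) layers lie outside
-- that family, and the bound follows by induction on d and m.

module Submission where

open import Defs
open import Data.Nat using (ℕ; zero; suc; _+_; _*_; _∸_; _^_; _≤_; _<_; z≤n; s≤s; z<s; _≤?_; ⌊_/2⌋; ⌈_/2⌉; NonZero)
open import Data.Nat.Properties
open import Data.Nat.Induction using (<-rec)
open import Data.Nat.Logarithm using (⌊log₂_⌋; ⌊log₂⌋-mono-≤)
open import Data.Nat.Logarithm.Core using (⌊log2⌋-acc-irrelevant)
open import Data.Nat.Tactic.RingSolver using (solve-∀)
open import Data.Fin as Fin using (Fin)
open import Data.Fin.Properties using (any?)
open import Data.Fin.Subset
open import Data.Fin.Subset.Properties
open import Data.Vec using (_∷_; []; tabulate; here; there)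
open import Data.Vec.Properties using (lookup∘tabulate; []=⇒lookup; lookup⇒[]=)
open import Data.Maybe using (just)
open import Data.Maybe.Properties using (just-injective)
import Data.Maybe.Properties as Maybe
open import Data.Bool using (true)
import Data.Bool.Properties as Bool
open import Data.Unit using (tt)
open import Data.Product using (∃; ∃-syntax; _×_; _,_; proj₁; proj₂)
open import Data.Sum using (inj₁; inj₂; [_,_]′)
open import Data.Empty using (⊥-elim)
open import Function using (_∘_)
open import Relation.Nullary using (Dec; yes; no; does; contradiction)
open import Relation.Nullary.Decidable using (_×-dec_; ¬?; dec-true; map′)
open import Relation.Unary using (Pred; Decidable)
open import Relation.Binary.PropositionalEquality

-- Halving, logarithms and powers

2*⌊n/2⌋≤n : ∀ n → 2 * ⌊ n /2⌋ ≤ n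
2*⌊n/2⌋≤n n = begin
  2 * ⌊ n /2⌋          ≡⟨ cong (⌊ n /2⌋ +_) (+-identityʳ ⌊ n /2⌋) ⟩
  ⌊ n /2⌋ + ⌊ n /2⌋    ≤⟨ +-monoʳ-≤ ⌊ n /2⌋ (⌊n/2⌋≤⌈n/2⌉ n) ⟩
  ⌊ n /2⌋ + ⌈ n /2⌉    ≡⟨ ⌊n/2⌋+⌈n/2⌉≡n n ⟩
  n                    ∎
  where open ≤-Reasoning

n≤1+2*⌊n/2⌋ : ∀ n → n ≤ suc (2 * ⌊ n /2⌋)
n≤1+2*⌊n/2⌋ n = begin
  n                         ≡⟨ ⌊n/2⌋+⌈n/2⌉≡n n ⟨
  ⌊ n /2⌋ + ⌈ n /2⌉         ≤⟨ +-monoʳ-≤ ⌊ n /2⌋ (⌊n/2⌋-mono (n≤1+n (suc n))) ⟩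
  ⌊ n /2⌋ + suc ⌊ n /2⌋     ≡⟨ +-suc ⌊ n /2⌋ ⌊ n /2⌋ ⟩
  suc (⌊ n /2⌋ + ⌊ n /2⌋)   ≡⟨ cong (λ h → suc (⌊ n /2⌋ + h)) (+-identityʳ ⌊ n /2⌋) ⟨
  suc (2 * ⌊ n /2⌋)         ∎
  where open ≤-Reasoning

⌊log₂[2+n]⌋≡1+⌊log₂[1+⌊n/2⌋]⌋ : ∀ n → ⌊log₂ (2 + n) ⌋ ≡ suc ⌊log₂ (suc ⌊ n /2⌋) ⌋
⌊log₂[2+n]⌋≡1+⌊log₂[1+⌊n/2⌋]⌋ n = cong suc (⌊log2⌋-acc-irrelevant (suc ⌊ n /2⌋))

2^⌊log₂n⌋≤n : ∀ n .{{_ : NonZero n}} → 2 ^ ⌊log₂ n ⌋ ≤ n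
2^⌊log₂n⌋≤n n = 2^L≤n refl
  where
  2^L≤n : ∀ {L n} .{{_ : NonZero n}} → ⌊log₂ n ⌋ ≡ L → 2 ^ L ≤ n
  2^L≤n {zero} {suc _} _ = s≤s z≤n
  2^L≤n {suc L} {suc (suc n)} eq = begin
    2 * 2 ^ L                ≤⟨ *-monoʳ-≤ 2 (2^L≤n {n = suc ⌊ n /2⌋} log-half) ⟩
    2 * ⌊ 2 + n /2⌋          ≤⟨ 2*⌊n/2⌋≤n (2 + n) ⟩
    2 + n                    ∎
    where
    open ≤-Reasoning
    log-half : ⌊log₂ (suc ⌊ n /2⌋) ⌋ ≡ L
    log-half = suc-injective (trans (sym (⌊log₂[2+n]⌋≡1+⌊log₂[1+⌊n/2⌋]⌋ n)) eq)

^-distribʳ-* : ∀ m n o → (m * n) ^ o ≡ m ^ o * n ^ o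
^-distribʳ-* m n zero = refl
^-distribʳ-* m n (suc o) = begin
  m * n * (m * n) ^ o        ≡⟨ cong (m * n *_) (^-distribʳ-* m n o) ⟩
  m * n * (m ^ o * n ^ o)    ≡⟨ [m*n]*[o*p]≡[m*o]*[n*p] m n (m ^ o) (n ^ o) ⟩
  m * m ^ o * (n * n ^ o)    ∎
  where open ≡-Reasoning

[m^n]^o≡[m^o]^n : ∀ m n o → (m ^ n) ^ o ≡ (m ^ o) ^ n
[m^n]^o≡[m^o]^n m n o = begin
  (m ^ n) ^ o    ≡⟨ ^-*-assoc m n o ⟩
  m ^ (n * o)    ≡⟨ cong (m ^_) (*-comm n o) ⟩
  m ^ (o * n)    ≡⟨ ^-*-assoc m o n ⟨
  (m ^ o) ^ n    ∎
  where open ≡-Reasoning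

-- An integer form of m ^ (1 + log₂ d) = m · d ^ log₂ m, which it does not exceed.
maxLayers : ℕ → ℕ → ℕ
maxLayers d m = m * d ^ ⌊log₂ m ⌋

maxLayers-recurrence : ∀ c m₀ → let f = maxLayers (suc c) ⌊ m₀ /2⌋ in
                       suc f + maxLayers c (2 + m₀) + suc f ≤ maxLayers (suc c) (2 + m₀)
maxLayers-recurrence c m₀ = begin
  suc f + m * c ^ ⌊log₂ m ⌋ + suc f         ≡⟨ cong (λ k → suc f + m * c ^ k + suc f) log-m ⟩
  suc f + m * (c * c ^ L) + suc f           ≤⟨ +-mono-≤ (+-mono-≤ (s≤s f≤xP) (*-monoʳ-≤ m c*c^L≤c*P)) (s≤s f≤xP) ⟩
  suc (x * P) + m * (c * P) + suc (x * P)   ≡⟨ collect x P (m * (c * P)) ⟩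
  2 + 2 * x * P + m * (c * P)               ≤⟨ +-monoˡ-≤ (m * (c * P)) 2+2xP≤mP ⟩
  m * P + m * (c * P)                       ≡⟨ *-distribˡ-+ m P (c * P) ⟨
  m * (suc c * P)                           ≡⟨ cong (λ k → m * suc c ^ k) log-m ⟨
  m * suc c ^ ⌊log₂ m ⌋                     ∎
  where
  open ≤-Reasoning
  x = ⌊ m₀ /2⌋
  m = 2 + m₀
  L = ⌊log₂ (suc x) ⌋
  log-m : ⌊log₂ m ⌋ ≡ suc L
  log-m = ⌊log₂[2+n]⌋≡1+⌊log₂[1+⌊n/2⌋]⌋ m₀
  P = suc c ^ L
  f = maxLayers (suc c) x
  f≤xP : f ≤ x * P
  f≤xP = *-monoʳ-≤ x (^-monoʳ-≤ (suc c) (⌊log₂⌋-mono-≤ (n≤1+n x)))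
  c*c^L≤c*P : c * c ^ L ≤ c * P
  c*c^L≤c*P = *-monoʳ-≤ c (^-monoˡ-≤ L (n≤1+n c))
  2+2xP≤mP : 2 + 2 * x * P ≤ m * P
  2+2xP≤mP = +-mono-≤ (m^n>0 (suc c) L) (+-mono-≤ (m^n>0 (suc c) L) (*-monoˡ-≤ P (2*⌊n/2⌋≤n m₀)))
  collect : ∀ x P y → suc (x * P) + y + suc (x * P) ≡ 2 + 2 * x * P + y
  collect = solve-∀

crossing-arith : ∀ {c x m u f D p q} → m ≤ 3 + 2 * x → u ≤ m + D → (2 + c) + f ≡ D →
                 x + D < p → x + D < q → u + f < p + q
crossing-arith {c} {x} {m} {u} {f} {p = p} {q} m≤3+2x u≤m+D refl x+D<p x+D<q = begin-strict
  u + f                                 ≤⟨ +-monoˡ-≤ f (≤-trans u≤m+D (+-monoˡ-≤ D m≤3+2x)) ⟩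
  3 + 2 * x + D + f                     <⟨ s≤s (m≤m+n _ c) ⟩
  suc (3 + 2 * x + D + f + c)           ≡⟨ collect x c f ⟩
  suc (x + D) + suc (x + D)             ≤⟨ +-mono-≤ x+D<p x+D<q ⟩
  p + q                                 ∎
  where
  open ≤-Reasoning
  D = 2 + c + f
  collect : ∀ x c f → suc (3 + 2 * x + (2 + c + f) + f + c) ≡ suc (x + (2 + c + f)) + suc (x + (2 + c + f))
  collect = solve-∀

≤maxLayers⇒LeqPowOnePlusLog₂ : ∀ {x m} d → x ≤ maxLayers d m → LeqPowOnePlusLog₂ x m d
≤maxLayers⇒LeqPowOnePlusLog₂ {m = zero} d z≤n p (suc q) _ _ = z≤n
≤maxLayers⇒LeqPowOnePlusLog₂ {x} {m@(suc _)} d x≤ p q _ d^q<2^p = begin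
  x ^ q                   ≤⟨ ^-monoˡ-≤ q x≤ ⟩
  (m * d ^ L) ^ q         ≡⟨ ^-distribʳ-* m (d ^ L) q ⟩
  m ^ q * (d ^ L) ^ q     ≡⟨ cong (m ^ q *_) ([m^n]^o≡[m^o]^n d L q) ⟩
  m ^ q * (d ^ q) ^ L     ≤⟨ *-monoʳ-≤ (m ^ q) (^-monoˡ-≤ L (<⇒≤ d^q<2^p)) ⟩
  m ^ q * (2 ^ p) ^ L     ≡⟨ cong (m ^ q *_) ([m^n]^o≡[m^o]^n 2 p L) ⟩
  m ^ q * (2 ^ L) ^ p     ≤⟨ *-monoʳ-≤ (m ^ q) (^-monoˡ-≤ p (2^⌊log₂n⌋≤n m)) ⟩
  m ^ q * m ^ p           ≡⟨ ^-distribˡ-+-* m q p ⟨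
  m ^ (q + p)             ∎
  where
  open ≤-Reasoning
  L = ⌊log₂ m ⌋

-- Finite sets

∣p∪q∣+∣p∩q∣≡∣p∣+∣q∣ : ∀ {n} (p q : Subset n) → ∣ p ∪ q ∣ + ∣ p ∩ q ∣ ≡ ∣ p ∣ + ∣ q ∣
∣p∪q∣+∣p∩q∣≡∣p∣+∣q∣ [] [] = refl
∣p∪q∣+∣p∩q∣≡∣p∣+∣q∣ (inside ∷ p) (inside ∷ q) =
  cong suc (trans (+-suc _ _) (trans (cong suc (∣p∪q∣+∣p∩q∣≡∣p∣+∣q∣ p q)) (sym (+-suc _ _))))
∣p∪q∣+∣p∩q∣≡∣p∣+∣q∣ (inside ∷ p) (outside ∷ q) = cong suc (∣p∪q∣+∣p∩q∣≡∣p∣+∣q∣ p q)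
∣p∪q∣+∣p∩q∣≡∣p∣+∣q∣ (outside ∷ p) (inside ∷ q) =
  trans (cong suc (∣p∪q∣+∣p∩q∣≡∣p∣+∣q∣ p q)) (sym (+-suc _ _))
∣p∪q∣+∣p∩q∣≡∣p∣+∣q∣ (outside ∷ p) (outside ∷ q) = ∣p∪q∣+∣p∩q∣≡∣p∣+∣q∣ p q

∣p∪⁅x⁆∣≡1+∣p∣ : ∀ {n} {p : Subset n} {x} → x ∉ p → ∣ p ∪ ⁅ x ⁆ ∣ ≡ suc ∣ p ∣
∣p∪⁅x⁆∣≡1+∣p∣ {p = outside ∷ p} {Fin.zero} _ = cong (suc ∘ ∣_∣) (∪-identityʳ p)
∣p∪⁅x⁆∣≡1+∣p∣ {p = inside ∷ p} {Fin.zero} x∉p = contradiction here x∉p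
∣p∪⁅x⁆∣≡1+∣p∣ {p = outside ∷ p} {Fin.suc x} x∉p = ∣p∪⁅x⁆∣≡1+∣p∣ (x∉p ∘ there)
∣p∪⁅x⁆∣≡1+∣p∣ {p = inside ∷ p} {Fin.suc x} x∉p = cong suc (∣p∪⁅x⁆∣≡1+∣p∣ (x∉p ∘ there))

module _ {n : ℕ} where

  p⊈q⇒∃∈∉ : ∀ {p q : Subset n} → p ⊈ q → ∃[ x ] (x ∈ p × x ∉ q)
  p⊈q⇒∃∈∉ {p} {q} p⊈q with any? (λ x → x ∈? p ×-dec ¬? (x ∈? q))
  ... | yes witness = witness
  ... | no none = ⊥-elim (p⊈q p⊆q)
    where
    p⊆q : p ⊆ q
    p⊆q {x} x∈p with x ∈? q
    ... | yes x∈q = x∈q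
    ... | no x∉q = contradiction (x , x∈p , x∉q) none

  ∣p∣<∣q∣⇒∃∈∉ : ∀ {p q : Subset n} → ∣ p ∣ < ∣ q ∣ → ∃[ x ] (x ∈ q × x ∉ p)
  ∣p∣<∣q∣⇒∃∈∉ ∣p∣<∣q∣ = p⊈q⇒∃∈∉ (λ q⊆p → <⇒≱ ∣p∣<∣q∣ (p⊆q⇒∣p∣≤∣q∣ q⊆p))

  p⊆q∧∣q∣≤∣p∣⇒p≡q : ∀ {p q : Subset n} → p ⊆ q → ∣ q ∣ ≤ ∣ p ∣ → p ≡ q
  p⊆q∧∣q∣≤∣p∣⇒p≡q {p} {q} p⊆q ∣q∣≤∣p∣ with q ⊆? p
  ... | yes q⊆p = ⊆-antisym p⊆q q⊆p
  ... | no q⊈p = contradiction (p⊂q⇒∣p∣<∣q∣ (p⊆q , p⊈q⇒∃∈∉ q⊈p)) (≤⇒≯ ∣q∣≤∣p∣)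

  p⊆r∧q⊆r⇒p∪q⊆r : ∀ {p q r : Subset n} → p ⊆ r → q ⊆ r → p ∪ q ⊆ r
  p⊆r∧q⊆r⇒p∪q⊆r {p} {q} p⊆r q⊆r x∈p∪q = [ p⊆r , q⊆r ]′ (x∈p∪q⁻ p q x∈p∪q)

  p⊆r∧q⊆r⇒∣p∣+∣q∣≤∣r∣+∣p∩q∣ : ∀ {p q r : Subset n} → p ⊆ r → q ⊆ r → ∣ p ∣ + ∣ q ∣ ≤ ∣ r ∣ + ∣ p ∩ q ∣
  p⊆r∧q⊆r⇒∣p∣+∣q∣≤∣r∣+∣p∩q∣ {p} {q} {r} p⊆r q⊆r = begin
    ∣ p ∣ + ∣ q ∣         ≡⟨ ∣p∪q∣+∣p∩q∣≡∣p∣+∣q∣ p q ⟨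
    ∣ p ∪ q ∣ + ∣ p ∩ q ∣ ≤⟨ +-monoˡ-≤ ∣ p ∩ q ∣ (p⊆q⇒∣p∣≤∣q∣ (p⊆r∧q⊆r⇒p∪q⊆r p⊆r q⊆r)) ⟩
    ∣ r ∣ + ∣ p ∩ q ∣     ∎
    where open ≤-Reasoning

  ∣r∣+∣s∣<∣p∣+∣q∣⇒∃∈p∩q∉s : ∀ {p q r s : Subset n} → p ⊆ r → q ⊆ r → ∣ r ∣ + ∣ s ∣ < ∣ p ∣ + ∣ q ∣ →
                           ∃[ x ] (x ∈ p × x ∈ q × x ∉ s)
  ∣r∣+∣s∣<∣p∣+∣q∣⇒∃∈p∩q∉s {p} {q} {r} {s} p⊆r q⊆r ∣r∣+∣s∣<∣p∣+∣q∣ =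
    let (x , x∈p∩q , x∉s) = ∣p∣<∣q∣⇒∃∈∉ (+-cancelˡ-< ∣ r ∣ _ _
                              (<-≤-trans ∣r∣+∣s∣<∣p∣+∣q∣ (p⊆r∧q⊆r⇒∣p∣+∣q∣≤∣r∣+∣p∩q∣ p⊆r q⊆r)))
        (x∈p , x∈q) = x∈p∩q⁻ p q x∈p∩q
    in x , x∈p , x∈q , x∉s

  fromDecidable : ∀ {ℓ} {P : Pred (Fin n) ℓ} → Decidable P → Subset n
  fromDecidable P? = tabulate (does ∘ P?)

  module _ {ℓ} {P : Pred (Fin n) ℓ} (P? : Decidable P) {x : Fin n} where

    ∈-fromDecidable⁺ : P x → x ∈ fromDecidable P?
    ∈-fromDecidable⁺ Px = lookup⇒[]= x _ (trans (lookup∘tabulate _ x) (dec-true (P? x) Px))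

    ∈-fromDecidable⁻ : x ∈ fromDecidable P? → P x
    ∈-fromDecidable⁻ x∈ = witness (P? x) (trans (sym (lookup∘tabulate _ x)) ([]=⇒lookup x∈))
      where
      witness : (Px? : Dec (P x)) → does Px? ≡ inside → P x
      witness (yes Px) _ = Px
      witness (no _)   ()

-- Connected layer families

-- A connected layer family (Eisenbrand, Hähnle, Razborov, Rothvoß) with layers 0 … N.  Its sets
-- have dimension D ∸ ∣ F ∣ relative to the common core F, and ∣ U ∣ ∸ D symbols to spare.
record LayerFamily {n : ℕ} (U F : Subset n) (D N : ℕ) : Set₁ where
  field
    Layer        : ℕ → Subset n → Set
    layer?       : ∀ i A → Dec (Layer i A)
    layer-unique : ∀ {i j A} → Layer i A → Layer j A → i ≡ j
    layer-card   : ∀ {i A} → Layer i A → ∣ A ∣ ≡ D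
    layer-⊆      : ∀ {i A} → Layer i A → A ⊆ U
    layer-⊇      : ∀ {i A} → Layer i A → F ⊆ A
    layer-≤      : ∀ {i A} → Layer i A → i ≤ N
    connected    : ∀ {i j k A B} → Layer i A → Layer j B → i < k → k < j →
                   ∃[ C ] (Layer k C × A ∩ B ⊆ C)
    bottom       : ∃ (Layer 0)
    top          : ∃ (Layer N)

  layer-nonempty : ∀ {i} → i ≤ N → ∃ (Layer i)
  layer-nonempty {zero} _ = bottom
  layer-nonempty {suc i} 1+i≤N with m≤n⇒m<n∨m≡n 1+i≤N
  ... | inj₂ refl = top
  ... | inj₁ 1+i<N = let (C , LC , _) = connected (proj₂ bottom) (proj₂ top) z<s 1+i<N in C , LC

  Layer≤ : ℕ → Subset n → Set
  Layer≤ i A = ∃[ j ] (j ≤ i × Layer j A)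

  layer≤? : ∀ i A → Dec (Layer≤ i A)
  layer≤? i A = map′ (λ (j , j<1+i , LA) → j , ≤-pred j<1+i , LA) (λ (j , j≤i , LA) → j , s≤s j≤i , LA)
                     (anyUpTo? (λ j → layer? j A) (suc i))

  ∈⋃≤? : ∀ i x → Dec (∃[ A ] (Layer≤ i A × x ∈ A))
  ∈⋃≤? i x = anySubset? (λ A → layer≤? i A ×-dec x ∈? A)

  ⋃≤ : ℕ → Subset n
  ⋃≤ i = fromDecidable (∈⋃≤? i)

  ⋃≤⁺ : ∀ {i j A} → Layer j A → j ≤ i → A ⊆ ⋃≤ i
  ⋃≤⁺ LA j≤i x∈A = ∈-fromDecidable⁺ (∈⋃≤? _) (_ , (_ , j≤i , LA) , x∈A)

  ⋃≤⁻ : ∀ {i x} → x ∈ ⋃≤ i → ∃[ A ] (Layer≤ i A × x ∈ A)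
  ⋃≤⁻ = ∈-fromDecidable⁻ (∈⋃≤? _)

  ⋃≤-mono : ∀ {i j} → i ≤ j → ⋃≤ i ⊆ ⋃≤ j
  ⋃≤-mono i≤j x∈⋃ = let (A , (_ , k≤i , LA) , x∈A) = ⋃≤⁻ x∈⋃ in ⋃≤⁺ LA (≤-trans k≤i i≤j) x∈A

  ⋃≤⊆U : ∀ {i} → ⋃≤ i ⊆ U
  ⋃≤⊆U x∈⋃ = let (A , (_ , _ , LA) , x∈A) = ⋃≤⁻ x∈⋃ in layer-⊆ LA x∈A

module _ {n : ℕ} {U F : Subset n} {D N : ℕ} (L : LayerFamily U F D N) where
  open LayerFamily L

  narrow : ∀ {U′} → (∀ {i A} → Layer i A → A ⊆ U′) → LayerFamily U′ F D N
  narrow layer-⊆′ = record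
    { Layer = Layer ; layer? = layer? ; layer-unique = layer-unique ; layer-card = layer-card
    ; layer-⊆ = layer-⊆′ ; layer-⊇ = layer-⊇ ; layer-≤ = layer-≤ ; connected = connected
    ; bottom = bottom ; top = top
    }

  slice : ∀ {a b A B} → Layer a A → Layer b B → a ≤ b → LayerFamily U F D (b ∸ a)
  slice {a} {b} {A} {B} LA LB a≤b = record
    { Layer        = λ k C → Layer (k + a) C × k + a ≤ b
    ; layer?       = λ k C → layer? (k + a) C ×-dec (k + a ≤? b)
    ; layer-unique = λ (LC , _) (LC′ , _) → +-cancelʳ-≡ a _ _ (layer-unique LC LC′)
    ; layer-card   = layer-card ∘ proj₁
    ; layer-⊆      = layer-⊆ ∘ proj₁
    ; layer-⊇      = layer-⊇ ∘ proj₁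
    ; layer-≤      = λ (_ , k+a≤b) → m+n≤o⇒m≤o∸n _ k+a≤b
    ; connected    = λ (LC , _) (LC′ , j+a≤b) i<k k<j →
        let (C , LC″ , ⊆C) = connected LC LC′ (+-monoˡ-< a i<k) (+-monoˡ-< a k<j)
        in C , (LC″ , <⇒≤ (<-≤-trans (+-monoˡ-< a k<j) j+a≤b)) , ⊆C
    ; bottom       = A , LA , a≤b
    ; top          = B , subst (λ j → Layer j B × j ≤ b) (sym (m∸n+n≡m a≤b)) (LB , ≤-refl)
    }

  reverse : LayerFamily U F D N
  reverse = record
    { Layer        = λ k A → Layer (N ∸ k) A × k ≤ N
    ; layer?       = λ k A → layer? (N ∸ k) A ×-dec (k ≤? N)
    ; layer-unique = λ (LA , i≤N) (LA′ , j≤N) → ∸-cancelˡ-≡ i≤N j≤N (layer-unique LA LA′)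
    ; layer-card   = layer-card ∘ proj₁
    ; layer-⊆      = layer-⊆ ∘ proj₁
    ; layer-⊇      = layer-⊇ ∘ proj₁
    ; layer-≤      = proj₂
    ; connected    = λ {i} {j} {k} {A} {B} (LA , _) (LB , j≤N) i<k k<j →
        let k≤N = <⇒≤ (<-≤-trans k<j j≤N)
            (C , LC , ⊆C) = connected LB LA (∸-monoʳ-< k<j j≤N) (∸-monoʳ-< i<k k≤N)
        in C , (LC , k≤N) , subst (_⊆ C) (∩-comm B A) ⊆C
    ; bottom       = let (B , LB) = top in B , LB , z≤n
    ; top          = let (A , LA) = bottom in A , subst (λ i → Layer i A) (sym (n∸n≡0 N)) LA , ≤-refl
    }

  containing : ∀ s → s ∈ proj₁ bottom → s ∈ proj₁ top → LayerFamily U (F ∪ ⁅ s ⁆) D N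
  containing s s∈bottom s∈top = record
    { Layer        = λ i A → Layer i A × s ∈ A
    ; layer?       = λ i A → layer? i A ×-dec s ∈? A
    ; layer-unique = λ (LA , _) (LA′ , _) → layer-unique LA LA′
    ; layer-card   = layer-card ∘ proj₁
    ; layer-⊆      = layer-⊆ ∘ proj₁
    ; layer-⊇      = λ {_} {A} (LA , s∈A) x∈F∪⁅s⁆ →
        [ layer-⊇ LA , (λ x∈⁅s⁆ → subst (_∈ A) (sym (x∈⁅y⁆⇒x≡y s x∈⁅s⁆)) s∈A) ]′ (x∈p∪q⁻ F ⁅ s ⁆ x∈F∪⁅s⁆)
    ; layer-≤      = layer-≤ ∘ proj₁
    ; connected    = λ (LA , s∈A) (LB , s∈B) i<k k<j →
        let (C , LC , ⊆C) = connected LA LB i<k k<j in C , (LC , ⊆C (x∈p∩q⁺ (s∈A , s∈B))) , ⊆C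
    ; bottom       = proj₁ bottom , proj₂ bottom , s∈bottom
    ; top          = proj₁ top , proj₂ top , s∈top
    }

module _ {n : ℕ} {U F : Subset n} {D N : ℕ} (L : LayerFamily U F D N) where
  open LayerFamily L

  ⊆-layer⇒≡ : ∀ {i j A B} → Layer i A → Layer j B → A ⊆ B → A ≡ B
  ⊆-layer⇒≡ LA LB A⊆B = p⊆q∧∣q∣≤∣p∣⇒p≡q A⊆B (≤-reflexive (trans (layer-card LB) (sym (layer-card LA))))

  distinct-layers⇒∃∈∉ : ∀ {i j A B} → Layer i A → Layer j B → i ≢ j → ∃[ x ] (x ∈ A × x ∉ B)
  distinct-layers⇒∃∈∉ LA LB i≢j =
    p⊈q⇒∃∈∉ (λ A⊆B → i≢j (layer-unique LA (subst (Layer _) (sym (⊆-layer⇒≡ LA LB A⊆B)) LB)))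

  ∣U∣≤D⇒N≡0 : ∣ U ∣ ≤ D → N ≡ 0
  ∣U∣≤D⇒N≡0 ∣U∣≤D = sym (layer-unique LA (subst (Layer N) (trans (≡U LB) (sym (≡U LA))) LB))
    where
    LA = proj₂ bottom
    LB = proj₂ top
    ≡U : ∀ {i A} → Layer i A → A ≡ U
    ≡U LA = p⊆q∧∣q∣≤∣p∣⇒p≡q (layer-⊆ LA) (subst (∣ U ∣ ≤_) (sym (layer-card LA)) ∣U∣≤D)

  three-layers⇒2+D≤∣U∣ : ∀ {i j k A B C} → Layer i A → Layer j B → Layer k C → i ≢ k → j ≢ k →
                         A ∩ B ⊆ C → 2 + D ≤ ∣ U ∣
  three-layers⇒2+D≤∣U∣ {A = A} {B} {C} LA LB LC i≢k j≢k A∩B⊆C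
    with distinct-layers⇒∃∈∉ LA LC i≢k | distinct-layers⇒∃∈∉ LB LC j≢k
  ... | a , a∈A , a∉C | b , b∈B , b∉C = begin
    2 + D               ≡⟨ cong (2 +_) (layer-card LC) ⟨
    2 + ∣ C ∣           ≤⟨ s≤s (p⊂q⇒∣p∣<∣q∣ (p⊆p∪q A , a , q⊆p∪q C A a∈A , a∉C)) ⟩
    suc ∣ C ∪ A ∣       ≤⟨ p⊂q⇒∣p∣<∣q∣ (p⊆p∪q B , b , q⊆p∪q (C ∪ A) B b∈B , b∉C∪A) ⟩
    ∣ (C ∪ A) ∪ B ∣     ≤⟨ p⊆q⇒∣p∣≤∣q∣ (p⊆r∧q⊆r⇒p∪q⊆r (p⊆r∧q⊆r⇒p∪q⊆r (layer-⊆ LC) (layer-⊆ LA))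
                                                        (layer-⊆ LB)) ⟩
    ∣ U ∣               ∎
    where
    open ≤-Reasoning
    b∉C∪A : b ∉ C ∪ A
    b∉C∪A b∈C∪A = [ b∉C , (λ b∈A → b∉C (A∩B⊆C (x∈p∩q⁺ (b∈A , b∈B)))) ]′ (x∈p∪q⁻ C A b∈C∪A)

  ∣U∣≤1+D⇒N≤1 : ∣ U ∣ ≤ suc D → N ≤ 1
  ∣U∣≤1+D⇒N≤1 ∣U∣≤1+D = ≮⇒≥ λ 1<N →
    let (C , LC , A∩B⊆C) = connected (proj₂ bottom) (proj₂ top) z<s 1<N
    in ≤⇒≯ ∣U∣≤1+D (three-layers⇒2+D≤∣U∣ (proj₂ bottom) (proj₂ top) LC (λ ()) (>⇒≢ 1<N) A∩B⊆C)

LayerBound : ℕ → ℕ → Set₁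
LayerBound d m = ∀ {n} {U F : Subset n} {D N} → LayerFamily U F D N → d + ∣ F ∣ ≡ D → ∣ U ∣ ≤ m + D →
                 N ≤ maxLayers d m

module _ {n : ℕ} {U F : Subset n} {D N : ℕ} (L : LayerFamily U F D N) (1+∣F∣≡D : suc ∣ F ∣ ≡ D) where
  open LayerFamily L

  shared-new-symbol⇒≡ : ∀ {i j A B x} → Layer i A → Layer j B → x ∉ F → x ∈ A → x ∈ B → A ≡ B
  shared-new-symbol⇒≡ {A = A} {B} {x} LA LB x∉F x∈A x∈B =
    trans (sym (A∩B≡ LA (p∩q⊆p A B))) (A∩B≡ LB (p∩q⊆q A B))
    where
    F⊆A∩B : F ⊆ A ∩ B
    F⊆A∩B y∈F = x∈p∩q⁺ (layer-⊇ LA y∈F , layer-⊇ LB y∈F)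
    D≤∣A∩B∣ : D ≤ ∣ A ∩ B ∣
    D≤∣A∩B∣ = subst (_≤ ∣ A ∩ B ∣) 1+∣F∣≡D (p⊂q⇒∣p∣<∣q∣ (F⊆A∩B , x , x∈p∩q⁺ (x∈A , x∈B) , x∉F))
    A∩B≡ : ∀ {j C} → Layer j C → A ∩ B ⊆ C → A ∩ B ≡ C
    A∩B≡ LC ⊆C = p⊆q∧∣q∣≤∣p∣⇒p≡q ⊆C (≤-trans (≤-reflexive (layer-card LC)) D≤∣A∩B∣)

  ⋃≤-grows : ∀ {i A} → Layer (suc i) A → ⋃≤ i ⊂ ⋃≤ (suc i)
  ⋃≤-grows {i} {A} LA with ∣p∣<∣q∣⇒∃∈∉ (≤-reflexive (trans 1+∣F∣≡D (sym (layer-card LA))))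
  ... | x , x∈A , x∉F = ⋃≤-mono (n≤1+n i) , x , ⋃≤⁺ LA ≤-refl x∈A , x∉⋃≤i
    where
    x∉⋃≤i : x ∉ ⋃≤ i
    x∉⋃≤i x∈⋃ =
      let (B , (j , j≤i , LB) , x∈B) = ⋃≤⁻ x∈⋃
          A≡B = shared-new-symbol⇒≡ LA LB x∉F x∈A x∈B
      in ≤⇒≯ j≤i (≤-reflexive (layer-unique LA (subst (Layer j) (sym A≡B) LB)))

  i+D≤∣⋃≤i∣ : ∀ {i} → i ≤ N → i + D ≤ ∣ ⋃≤ i ∣
  i+D≤∣⋃≤i∣ {zero} _ =
    let (A , LA) = bottom in subst (_≤ ∣ ⋃≤ 0 ∣) (layer-card LA) (p⊆q⇒∣p∣≤∣q∣ (⋃≤⁺ LA ≤-refl))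
  i+D≤∣⋃≤i∣ {suc i} 1+i≤N =
    ≤-trans (s≤s (i+D≤∣⋃≤i∣ (<⇒≤ 1+i≤N))) (p⊂q⇒∣p∣<∣q∣ (⋃≤-grows (proj₂ (layer-nonempty 1+i≤N))))

dimension-one-bound : ∀ m → LayerBound 1 m
dimension-one-bound m {D = D} {N} L 1+∣F∣≡D ∣U∣≤m+D = begin
  N                 ≤⟨ +-cancelʳ-≤ D N m N+D≤m+D ⟩
  m                 ≡⟨ *-identityʳ m ⟨
  m * 1             ≡⟨ cong (m *_) (^-zeroˡ ⌊log₂ m ⌋) ⟨
  maxLayers 1 m     ∎
  where
  open ≤-Reasoning
  open LayerFamily L
  N+D≤m+D : N + D ≤ m + D
  N+D≤m+D = ≤-trans (i+D≤∣⋃≤i∣ L 1+∣F∣≡D ≤-refl) (≤-trans (p⊆q⇒∣p∣≤∣q∣ ⋃≤⊆U) ∣U∣≤m+D)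

module _ {n : ℕ} {U F : Subset n} {D N : ℕ} (L : LayerFamily U F D N) where
  open LayerFamily L

  prefix : ∀ {i} → i ≤ N → LayerFamily (⋃≤ i) F D i
  prefix i≤N = narrow (slice L (proj₂ bottom) (proj₂ (layer-nonempty i≤N)) z≤n) 
                 (λ (LA , k≤i) → ⋃≤⁺ LA k≤i)

  prefix-bound : ∀ {d x i} → LayerBound d x → d + ∣ F ∣ ≡ D → i ≤ N → ∣ ⋃≤ i ∣ ≤ x + D →
                 i ≤ maxLayers d x
  prefix-bound bound-x d+∣F∣≡D i≤N = bound-x (prefix i≤N) d+∣F∣≡D

  long⇒⋃≤-exceeds : ∀ {d x} → LayerBound d x → d + ∣ F ∣ ≡ D → suc (maxLayers d x) ≤ N →
                    x + D < ∣ ⋃≤ (suc (maxLayers d x)) ∣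
  long⇒⋃≤-exceeds bound-x d+∣F∣≡D 1+f≤N = ≰⇒> (1+n≰n ∘ prefix-bound bound-x d+∣F∣≡D 1+f≤N)

  middle-bound : ∀ {d m a b A B s} → LayerBound d m → suc d + ∣ F ∣ ≡ D → ∣ U ∣ ≤ m + D → s ∉ F →
                 Layer a A → s ∈ A → Layer b B → s ∈ B → b ∸ a ≤ maxLayers d m
  middle-bound {d} {m} {a} {b} {s = s} bound-mid 1+d+∣F∣≡D ∣U∣≤m+D s∉F LA s∈A LB s∈B with a ≤? b
  ... | yes a≤b = bound-mid (containing (slice L LA LB a≤b) s s∈A s∈B) d+∣F∪⁅s⁆∣≡D ∣U∣≤m+D
    where
    d+∣F∪⁅s⁆∣≡D : d + ∣ F ∪ ⁅ s ⁆ ∣ ≡ D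
    d+∣F∪⁅s⁆∣≡D = trans (cong (d +_) (∣p∪⁅x⁆∣≡1+∣p∣ s∉F)) (trans (+-suc d ∣ F ∣) 1+d+∣F∣≡D)
  ... | no a≰b = subst (_≤ maxLayers d m) (sym (m≤n⇒m∸n≡0 (<⇒≤ (≰⇒> a≰b)))) z≤n

halving-step : ∀ {c x m} → LayerBound (2 + c) x → LayerBound (1 + c) m → m ≤ 3 + 2 * x →
               ∀ {n} {U F : Subset n} {D N} → LayerFamily U F D N → (2 + c) + ∣ F ∣ ≡ D → ∣ U ∣ ≤ m + D →
               let f = maxLayers (2 + c) x in N ≤ suc f + maxLayers (1 + c) m + suc f
halving-step {c} {x} {m} bound-x bound-mid m≤3+2x {U = U} {F} {D} {N} L d+∣F∣≡D ∣U∣≤m+D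
  with suc (maxLayers (2 + c) x) ≤? N
... | no N≱1+f = ≤-trans (≤-pred (≰⇒> N≱1+f)) (≤-trans (n≤1+n _) (≤-trans (m≤m+n _ _) (m≤m+n _ _)))
... | yes 1+f≤N = via (∣r∣+∣s∣<∣p∣+∣q∣⇒∃∈p∩q∉s ⋃≤⊆U R.⋃≤⊆U ends-exceed-U)
  where
  open LayerFamily L
  module R = LayerFamily (reverse L)
  f = maxLayers (2 + c) x
  g = maxLayers (1 + c) m
  ends-exceed-U : ∣ U ∣ + ∣ F ∣ < ∣ ⋃≤ (suc f) ∣ + ∣ R.⋃≤ (suc f) ∣
  ends-exceed-U = crossing-arith m≤3+2x ∣U∣≤m+D d+∣F∣≡D (long⇒⋃≤-exceeds L bound-x d+∣F∣≡D 1+f≤N)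
                    (long⇒⋃≤-exceeds (reverse L) bound-x d+∣F∣≡D 1+f≤N)
  via : ∃[ s ] (s ∈ ⋃≤ (suc f) × s ∈ R.⋃≤ (suc f) × s ∉ F) → N ≤ suc f + g + suc f
  via (s , s∈first , s∈last , s∉F) with ⋃≤⁻ s∈first | R.⋃≤⁻ s∈last
  ... | A , (a , a≤1+f , LA) , s∈A | B , (b′ , b′≤1+f , LB , b′≤N) , s∈B = begin
    N                         ≤⟨ m≤n+m∸n N b ⟩
    b + (N ∸ b)               ≤⟨ +-monoˡ-≤ (N ∸ b) (m≤n+m∸n b a) ⟩
    a + (b ∸ a) + (N ∸ b)     ≡⟨ cong (a + (b ∸ a) +_) (m∸[m∸n]≡n b′≤N) ⟩
    a + (b ∸ a) + b′          ≤⟨ +-mono-≤ (+-mono-≤ a≤1+f b∸a≤g) b′≤1+f ⟩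
    suc f + g + suc f         ∎
    where
    open ≤-Reasoning
    b = N ∸ b′
    b∸a≤g : b ∸ a ≤ g
    b∸a≤g = middle-bound L bound-mid d+∣F∣≡D ∣U∣≤m+D s∉F LA s∈A LB s∈B

layer-bound : ∀ c m → LayerBound (suc c) m
layer-bound zero = dimension-one-bound
layer-bound (suc c) = <-rec (LayerBound (2 + c)) bound-below
  where
  bound-below : ∀ m → (∀ {x} → x < m → LayerBound (2 + c) x) → LayerBound (2 + c) m
  bound-below zero _ L _ ∣U∣≤D = ≤-reflexive (∣U∣≤D⇒N≡0 L ∣U∣≤D)
  bound-below (suc zero) _ L _ ∣U∣≤1+D = ∣U∣≤1+D⇒N≤1 L ∣U∣≤1+D
  bound-below (suc (suc m₀)) smaller L d+∣F∣≡D ∣U∣≤m+D = ≤-trans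
    (halving-step (smaller (s≤s (≤-trans (⌊n/2⌋≤n m₀) (n≤1+n m₀)))) (layer-bound c (2 + m₀))
                  (s≤s (s≤s (n≤1+2*⌊n/2⌋ m₀))) L d+∣F∣≡D ∣U∣≤m+D)
    (maxLayers-recurrence (suc c) m₀)

-- Distance layers of a subset partition graph

minimal-witness : ∀ {ℓ} {P : Pred ℕ ℓ} → Decidable P → ∀ {n} → P n → ∃[ m ] (P m × ∀ {k} → P k → m ≤ k)
minimal-witness P? {n} Pn with P? 0
... | yes P0 = 0 , P0 , λ _ → z≤n
minimal-witness P? {zero} P0 | no ¬P0 = contradiction P0 ¬P0
minimal-witness P? {suc n} Pn | no ¬P0 =
  let (m , Pm , m-minimal) = minimal-witness (P? ∘ suc) Pn
  in suc m , Pm , λ { {zero} P0 → contradiction P0 ¬P0 ; {suc k} Pk → s≤s (m-minimal Pk) }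

module _ {d n : ℕ} (G : SPGraph d n) where
  open SPGraph G

  walk? : ∀ ℓ i j → Dec (Walk AllV i j ℓ)
  walk? zero i j with i Fin.≟ j
  ... | yes refl = yes (here tt)
  ... | no i≢j = no λ { (here _) → i≢j refl }
  walk? (suc ℓ) i j = map′ (λ (i′ , e , W) → step tt e W) (λ { (step _ e W) → _ , e , W })
                           (any? λ i′ → (adj i i′ Bool.≟ true) ×-dec walk? ℓ i′ j)

module Distance {d n : ℕ} (G : SPGraph d n) (G-connected : SPGraph.Connected G) where
  open SPGraph G

  shortest : ∀ i j → ∃[ ℓ ] (Walk AllV i j ℓ × ∀ {ℓ′} → Walk AllV i j ℓ′ → ℓ ≤ ℓ′)
  shortest i j = minimal-witness (λ ℓ → walk? G ℓ i j) (proj₂ (G-connected i j))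

  distance : Fin k → Fin k → ℕ
  distance i j = proj₁ (shortest i j)

  distance-walk : ∀ i j → Walk AllV i j (distance i j)
  distance-walk i j = proj₁ (proj₂ (shortest i j))

  distance-minimal : ∀ {i j ℓ} → Walk AllV i j ℓ → distance i j ≤ ℓ
  distance-minimal {i} {j} = proj₂ (proj₂ (shortest i j))

  distance-step : ∀ {i i′ j} → adj i′ i ≡ true → distance i′ j ≤ suc (distance i j)
  distance-step {i} {j = j} e = distance-minimal (step tt e (distance-walk i j))

  intermediate-distance : ∀ {P a c ℓ k} v → Walk P a c ℓ → distance a v ≤ k → k ≤ distance c v →
                          ∃[ w ] (P w × distance w v ≡ k)
  intermediate-distance v (here Pa) a≤k k≤c = _ , Pa , ≤-antisym a≤k k≤c
  intermediate-distance {a = a} {k = k} v (step Pa e W) a≤k k≤c with distance a v ≟ k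
  ... | yes a≡k = a , Pa , a≡k
  ... | no a≢k = intermediate-distance v W (≤-trans (distance-step (adj-sym _ _ e)) (≤∧≢⇒< a≤k a≢k)) k≤c

  distance-layers : DimensionReduction → ∀ u v → LayerFamily ⊤ ⊥ d (distance u v)
  distance-layers dr u v = record
    { Layer        = Layer
    ; layer?       = λ i A → any? (λ w → Maybe.≡-dec Fin._≟_ (part A) (just w) ×-dec (distance w v ≟ i))
                               ×-dec (i ≤? N)
    ; layer-unique = λ ((_ , eA , wA-at-i) , _) ((_ , eA′ , wA-at-j) , _) →
                       trans (sym wA-at-i) (trans (cong (λ w → distance w v) (just-injective (trans (sym eA) eA′)))
                                                  wA-at-j)
    ; layer-card   = λ {_} {A} ((w , eA , _) , _) → part-dim A w eA
    ; layer-⊆      = λ _ → ⊆⊤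
    ; layer-⊇      = λ _ → ⊥⊆
    ; layer-≤      = proj₂
    ; connected    = connected
    ; bottom       = let (A , eA) = nonempty v
                     in A , (v , eA , n≤0⇒n≡0 (distance-minimal {v} (here tt))) , z≤n
    ; top          = let (B , eB) = nonempty u in B , (u , eB , refl) , ≤-refl
    }
    where
    N = distance u v
    Layer : ℕ → Subset n → Set
    Layer i A = (∃[ w ] (part A ≡ just w × distance w v ≡ i)) × i ≤ N
    connected : ∀ {i j k A B} → Layer i A → Layer j B → i < k → k < j → ∃[ C ] (Layer k C × A ∩ B ⊆ C)
    connected {k = k} {A} {B} ((wa , eA , refl) , _) ((wb , eB , refl) , j≤N) i<k k<j
      with dr (A ∩ B) (≤-trans (∣p∩q∣≤∣p∣ A B) (≤-reflexive (part-dim A wa eA))) wa wb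
              (A , eA , p∩q⊆p A B) (B , eB , p∩q⊆q A B)
    ... | _ , W with intermediate-distance v W (<⇒≤ i<k) (<⇒≤ k<j)
    ... | w , (C , eC , A∩B⊆C) , w-at-k = C , ((w , eC , w-at-k) , ≤-trans (<⇒≤ k<j) j≤N) , A∩B⊆C

diameter≤maxLayers : ∀ {d n} (G : SPGraph d n) → 1 ≤ d → d ≤ n → SPGraph.Connected G →
                     SPGraph.DimensionReduction G → SPGraph.DiameterAtMost G (maxLayers d (n ∸ d))
diameter≤maxLayers {suc c} {n} G (s≤s z≤n) d≤n G-connected dr u v =
  distance u v , layer-bound c (n ∸ suc c) (distance-layers dr u v) d+∣⊥∣≡D ∣⊤∣≤m+D , distance-walk u v
  where
  open Distance G G-connected
  d+∣⊥∣≡D : suc c + ∣ ⊥ {n} ∣ ≡ suc c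
  d+∣⊥∣≡D = trans (cong (suc c +_) (∣⊥∣≡0 n)) (+-identityʳ (suc c))
  ∣⊤∣≤m+D : ∣ ⊤ {n} ∣ ≤ n ∸ suc c + suc c
  ∣⊤∣≤m+D = ≤-reflexive (trans (∣⊤∣≡n n) (sym (m∸n+n≡m d≤n)))

theorem3 : ∀ (d n : ℕ) → 1 ≤ d → d ≤ n → (G : SPGraph d n) →
    SPGraph.Connected G → SPGraph.DimensionReduction G →
    ∀ (b : ℕ) → SPGraph.DiameterAtMost G b →
    (∀ b′ → SPGraph.DiameterAtMost G b′ → b ≤ b′) →
    LeqPowOnePlusLog₂ b (n ∸ d) d
theorem3 d n 1≤d d≤n G G-connected dr b _ b-minimal =
  ≤maxLayers⇒LeqPowOnePlusLog₂ d (b-minimal _ (diameter≤maxLayers G 1≤d d≤n G-connected dr))
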